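{- Let $H=(V,E)$ be a hypergraph and let $G_H$ be its auxiliary graph. For any hyperedge $e\in E$, $\kappa_e\ge k_e$, where $\kappa_e=\min_{f\in F_e}k_f$.
   Context: The auxiliary graph $G_H$ is the ordinary multigraph on $V$ obtained by replacing each hyperedge $e$ by a clique $F_e$ on the vertices of $e$. For a hyperedge $e$ of $H$, its strength $k_e$ is the largest minimum cut size of the induced subhypergraph $H[X]$ over all $X\subseteq V$ with $e\subseteq X$ (where $H[X]$ contains the hyperedges fully inside $X$). For an edge $f$ of $G_H$, $k_f$ is its strength in $G_H$, defined analogously: the largest minimum cut size of $G_H[X]$ over all $X$ containing both endpoints of $f$. -}

module Defs where

open import Data.Bool using (Bool; true; false; _∧_; if_then_else_)
open import Data.Nat using (ℕ; zero; suc; _⊓_; _⊔_; _≤ᵇ_; _≡ᵇ_; _<ᵇ_)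
open import Data.Fin using (Fin; toℕ)
open import Data.Vec using (Vec; []; _∷_; lookup)
open import Data.List using (List; []; _∷_; [_]; map; _++_; foldr; concatMap; allFin; length)
open import Data.Fin.Subset using (Subset; inside; outside; _∩_; _∪_; ∁; ⁅_⁆; ∣_∣)

-- A hypergraph on vertex set V = Fin n: a finite multiset (list) of hyperedges,
-- each hyperedge a subset of V.  An ordinary multigraph is the special case in
-- which every hyperedge has exactly two vertices.
Hypergraph : ℕ → Set
Hypergraph n = List (Subset n)

allSubsets : ∀ n → List (Subset n)
allSubsets zero    = [ [] ]
allSubsets (suc n) = map (outside ∷_) (allSubsets n) ++ map (inside ∷_) (allSubsets n)

meets : ∀ {n} → Subset n → Subset n → Bool
meets a b = 1 ≤ᵇ ∣ a ∩ b ∣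

included : ∀ {n} → Subset n → Subset n → Bool
included a b = ∣ a ∩ ∁ b ∣ ≡ᵇ 0

-- S is a cut of X: ∅ ≠ S ⊊ X (S nonempty and X ∖ S nonempty)
isCut : ∀ {n} → Subset n → Subset n → Bool
isCut X S = included S X ∧ (meets S S ∧ meets X (∁ S))

crosses : ∀ {n} → Subset n → Subset n → Subset n → Bool
crosses X S e = included e X ∧ (meets e S ∧ meets e (X ∩ ∁ S))

cutValue : ∀ {n} → Hypergraph n → Subset n → Subset n → ℕ
cutValue H X S = foldr (λ e c → if crosses X S e then suc c else c) 0 H

-- minimum cut size of H[X]: minimum of cutValue over all cuts S of X.
-- (Initial value length H is an upper bound of every cut value, so for
--  |X| ≥ 2 this is exactly the minimum.)
minCut : ∀ {n} → Hypergraph n → Subset n → ℕ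
minCut {n} H X =
  foldr (λ S m → if isCut X S then cutValue H X S ⊓ m else m) (length H) (allSubsets n)

strength : ∀ {n} → Hypergraph n → Subset n → ℕ
strength {n} H e =
  foldr (λ X m → if included e X ∧ (2 ≤ᵇ ∣ X ∣) then minCut H X ⊔ m else m) 0 (allSubsets n)

clique : ∀ {n} → Subset n → List (Subset n)
clique {n} e =
  concatMap (λ u → concatMap (λ v →
      if (toℕ u <ᵇ toℕ v) ∧ (lookup e u ∧ lookup e v)
      then [ ⁅ u ⁆ ∪ ⁅ v ⁆ ] else [])
    (allFin n)) (allFin n)

auxGraph : ∀ {n} → Hypergraph n → Hypergraph n
auxGraph H = concatMap clique H

-- Let X ⊇ e have at least two vertices.  Both ends of f ∈ F_e lie in X, and
-- every hyperedge e' of H[X] crossing a cut (S, X ∖ S) has a vertex on each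
-- side, so the clique edge of F_{e'} joining them crosses the same cut in
-- G_H[X].  Hence every cut of G_H[X] is at least as large as the same cut of
-- H[X], so minCut H[X] ≤ minCut G_H[X] ≤ k_f, and maximising over X gives
-- k_e ≤ k_f.
module Submission where

open import Defs
open import Data.Nat using (ℕ; _≤_)
open import Data.Fin.Subset using (Subset)
open import Data.List.Membership.Propositional using (_∈_)

open import Data.Bool using (Bool; true; false; T; _∧_; if_then_else_)
open import Data.Bool.Properties using (T-∧; T-≡)
open import Data.Fin using (Fin; toℕ)
open import Data.Fin.Properties using (toℕ-injective)
open import Data.Vec using ([]; _∷_; lookup)
open import Data.Vec.Properties using (lookup⇒[]=; []=⇒lookup)
open import Data.Fin.Subset
  using (outside; inside; _∩_; _∪_; ∁; ⁅_⁆; ∣_∣; _⊆_; Nonempty; Empty)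
  renaming (_∈_ to _∈ˢ_; _∉_ to _∉ˢ_)
open import Data.Fin.Subset.Properties
  using ( nonempty?; Empty-unique; ∣⊥∣≡0; x∈⁅x⁆; x∈⁅y⁆⇒x≡y; ∣⁅x⁆∣≡1; p⊆q⇒∣p∣≤∣q∣
        ; x∈p⇒x∉∁p; x∉∁p⇒x∈p; x∉p⇒x∈∁p; x∈∁p⇒x∉p; x≢y⇒x∉⁅y⁆; x∈p∩q⁺; x∈p∩q⁻; p⊆p∪q; q⊆p∪q; x∈p∪q⁻; ∪-comm)
open import Data.List using (List; []; _∷_; [_]; _++_; foldr; length; allFin)
open import Data.List.Relation.Unary.Any using (here; there)
open import Data.List.Membership.Propositional using (find; lose)
open import Data.List.Membership.Propositional.Properties
  using (∈-concatMap⁺; ∈-concatMap⁻; ∈-allFin; ∈-++⁺ˡ; ∈-++⁺ʳ; ∈-map⁺)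
open import Data.Nat using (suc; _+_; _<_; _⊓_; _⊔_; _≤ᵇ_; z≤n; s≤s)
open import Data.Nat.Properties
open import Data.Product using (∃; ∃₂; _×_; _,_; proj₂)
open import Data.Sum using (inj₁; inj₂)
open import Function using (_∘_; Equivalence)
open import Relation.Binary.PropositionalEquality using (_≡_; _≢_; refl; sym; trans; cong; subst)
open import Relation.Binary using (tri<; tri≈; tri>)
open import Relation.Nullary using (yes; no; contradiction)

private
  variable
    n : ℕ
    x y : Fin n
    p q X S e : Subset n

open Equivalence using (to; from)

∈⇒1≤∣p∣ : x ∈ˢ p → 1 ≤ ∣ p ∣
∈⇒1≤∣p∣ {x = x} {p = p} x∈p =
  subst (_≤ ∣ p ∣) (∣⁅x⁆∣≡1 x) (p⊆q⇒∣p∣≤∣q∣ λ y∈⁅x⁆ → subst (_∈ˢ p) (sym (x∈⁅y⁆⇒x≡y x y∈⁅x⁆)) x∈p)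

Empty⇒∣p∣≡0 : ∀ {n} {p : Subset n} → Empty p → ∣ p ∣ ≡ 0
Empty⇒∣p∣≡0 {n} empty = trans (cong ∣_∣ (Empty-unique empty)) (∣⊥∣≡0 n)

1≤∣p∣⇒Nonempty : 1 ≤ ∣ p ∣ → Nonempty p
1≤∣p∣⇒Nonempty {p = p} 1≤∣p∣ with nonempty? p
... | yes nonempty = nonempty
... | no  empty    = contradiction (subst (1 ≤_) (Empty⇒∣p∣≡0 empty) 1≤∣p∣) λ ()

included⇒⊆ : T (included p q) → p ⊆ q
included⇒⊆ {p = p} {q = q} t x∈p = x∉∁p⇒x∈p λ x∈∁q →
  <-irrefl (sym (≡ᵇ⇒≡ _ 0 t)) (∈⇒1≤∣p∣ (x∈p∩q⁺ (x∈p , x∈∁q)))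

⊆⇒included : p ⊆ q → T (included p q)
⊆⇒included {p = p} {q = q} p⊆q = ≡⇒≡ᵇ _ 0 (Empty⇒∣p∣≡0 λ (x , x∈p∩∁q) →
  let x∈p , x∈∁q = x∈p∩q⁻ p (∁ q) x∈p∩∁q in x∈p⇒x∉∁p (p⊆q x∈p) x∈∁q)

meets⇒∃ : T (meets p q) → ∃ λ x → x ∈ˢ p × x ∈ˢ q
meets⇒∃ {p = p} {q = q} t =
  let x , x∈p∩q = 1≤∣p∣⇒Nonempty (≤ᵇ⇒≤ 1 _ t) in x , x∈p∩q⁻ p q x∈p∩q

∈⇒meets : x ∈ˢ p → x ∈ˢ q → T (meets p q)
∈⇒meets x∈p x∈q = ≤⇒≤ᵇ (∈⇒1≤∣p∣ (x∈p∩q⁺ (x∈p , x∈q)))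

isCut⁺ : S ⊆ X → x ∈ˢ S → y ∈ˢ X → y ∉ˢ S → T (isCut X S)
isCut⁺ S⊆X x∈S y∈X y∉S =
  from T-∧ (⊆⇒included S⊆X , from T-∧ (∈⇒meets x∈S x∈S , ∈⇒meets y∈X (x∉p⇒x∈∁p y∉S)))

crosses⁻ : T (crosses X S e) → e ⊆ X × ∃₂ λ x y → x ∈ˢ e × x ∈ˢ S × y ∈ˢ e × y ∉ˢ S
crosses⁻ {X = X} {S = S} t =
  let e⊆X , t′ = to T-∧ t
      tS , tX∖S = to T-∧ t′
      x , x∈e , x∈S = meets⇒∃ tS
      y , y∈e , y∈X∩∁S = meets⇒∃ tX∖S
  in included⇒⊆ e⊆X , x , y , x∈e , x∈S , y∈e , x∈∁p⇒x∉p (proj₂ (x∈p∩q⁻ X (∁ S) y∈X∩∁S))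

pair⊆ : x ∈ˢ p → y ∈ˢ p → ⁅ x ⁆ ∪ ⁅ y ⁆ ⊆ p
pair⊆ {x = x} {p = p} {y = y} x∈p y∈p z∈pair with x∈p∪q⁻ ⁅ x ⁆ ⁅ y ⁆ z∈pair
... | inj₁ z∈⁅x⁆ = subst (_∈ˢ p) (sym (x∈⁅y⁆⇒x≡y x z∈⁅x⁆)) x∈p
... | inj₂ z∈⁅y⁆ = subst (_∈ˢ p) (sym (x∈⁅y⁆⇒x≡y y z∈⁅y⁆)) y∈p

x∈⁅x⁆∪⁅y⁆ : ∀ (x y : Fin n) → x ∈ˢ ⁅ x ⁆ ∪ ⁅ y ⁆
x∈⁅x⁆∪⁅y⁆ x y = p⊆p∪q ⁅ y ⁆ (x∈⁅x⁆ x)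

y∈⁅x⁆∪⁅y⁆ : ∀ (x y : Fin n) → y ∈ˢ ⁅ x ⁆ ∪ ⁅ y ⁆
y∈⁅x⁆∪⁅y⁆ x y = q⊆p∪q ⁅ x ⁆ ⁅ y ⁆ (x∈⁅x⁆ y)

pair-crosses : x ∈ˢ X → y ∈ˢ X → x ∈ˢ S → y ∉ˢ S → T (crosses X S (⁅ x ⁆ ∪ ⁅ y ⁆))
pair-crosses {x = x} {y = y} x∈X y∈X x∈S y∉S = from T-∧
  ( ⊆⇒included (pair⊆ x∈X y∈X)
  , from T-∧ ( ∈⇒meets (x∈⁅x⁆∪⁅y⁆ x y) x∈S
             , ∈⇒meets (y∈⁅x⁆∪⁅y⁆ x y) (x∈p∩q⁺ (y∈X , x∉p⇒x∈∁p y∉S))))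

T-lookup⇒∈ : T (lookup p x) → x ∈ˢ p
T-lookup⇒∈ {p = p} {x = x} t = lookup⇒[]= x p (to T-≡ t)

∈⇒T-lookup : x ∈ˢ p → T (lookup p x)
∈⇒T-lookup x∈p = from T-≡ ([]=⇒lookup x∈p)

∈-if⁻ : ∀ {A : Set} {a b : A} c → a ∈ (if c then [ b ] else []) → T c × a ≡ b
∈-if⁻ true (here a≡b) = _ , a≡b
∈-if⁻ true (there ())

∈-if⁺ : ∀ {A : Set} {b : A} c → T c → b ∈ (if c then [ b ] else [])
∈-if⁺ true _ = here refl

∈-clique⁻ : ∀ {f} → f ∈ clique e →
  ∃₂ λ x y → toℕ x < toℕ y × x ∈ˢ e × y ∈ˢ e × f ≡ ⁅ x ⁆ ∪ ⁅ y ⁆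
∈-clique⁻ {e = e} f∈Fe =
  let x , _ , f∈Fe,x = find (∈-concatMap⁻ _ {xs = allFin _} f∈Fe)
      y , _ , f∈Fe,x,y = find (∈-concatMap⁻ _ {xs = allFin _} f∈Fe,x)
      t , f≡xy = ∈-if⁻ _ f∈Fe,x,y
      t< , t∈ = to T-∧ t
      x∈e , y∈e = to T-∧ t∈
  in x , y , <ᵇ⇒< _ _ t< , T-lookup⇒∈ x∈e , T-lookup⇒∈ y∈e , f≡xy

∈-clique-ordered : toℕ x < toℕ y → x ∈ˢ e → y ∈ˢ e → ⁅ x ⁆ ∪ ⁅ y ⁆ ∈ clique e
∈-clique-ordered {x = x} {y = y} x<y x∈e y∈e =
  ∈-concatMap⁺ _ (lose (∈-allFin x) (∈-concatMap⁺ _ (lose (∈-allFin y)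
    (∈-if⁺ _ (from T-∧ (<⇒<ᵇ x<y , from T-∧ (∈⇒T-lookup x∈e , ∈⇒T-lookup y∈e)))))))

∈-clique⁺ : x ∈ˢ e → y ∈ˢ e → x ≢ y → ⁅ x ⁆ ∪ ⁅ y ⁆ ∈ clique e
∈-clique⁺ {x = x} {e = e} {y = y} x∈e y∈e x≢y with <-cmp (toℕ x) (toℕ y)
... | tri< x<y _ _ = ∈-clique-ordered x<y x∈e y∈e
... | tri≈ _ x≡y _ = contradiction (toℕ-injective x≡y) x≢y
... | tri> _ _ y<x = subst (_∈ clique e) (∪-comm ⁅ y ⁆ ⁅ x ⁆) (∈-clique-ordered y<x y∈e x∈e)

clique-crosses : T (crosses X S e) → ∃ λ f → f ∈ clique e × T (crosses X S f)
clique-crosses {X = X} {S = S} {e = e} t =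
  let e⊆X , x , y , x∈e , x∈S , y∈e , y∉S = crosses⁻ {X = X} {S = S} {e = e} t
      x≢y x≡y = y∉S (subst (_∈ˢ _) x≡y x∈S)
  in _ , ∈-clique⁺ x∈e y∈e x≢y , pair-crosses (e⊆X x∈e) (e⊆X y∈e) x∈S y∉S

cutValue-++ : ∀ (A B : Hypergraph n) X S → cutValue (A ++ B) X S ≡ cutValue A X S + cutValue B X S
cutValue-++ []      B X S = refl
cutValue-++ (g ∷ A) B X S with crosses X S g
... | true  = cong suc (cutValue-++ A B X S)
... | false = cutValue-++ A B X S

cutValue≤length : ∀ (A : Hypergraph n) X S → cutValue A X S ≤ length A
cutValue≤length []      X S = z≤n
cutValue≤length (g ∷ A) X S with crosses X S g
... | true  = s≤s (cutValue≤length A X S)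
... | false = m≤n⇒m≤1+n (cutValue≤length A X S)

1≤cutValue : ∀ {A : Hypergraph n} {f} → f ∈ A → T (crosses X S f) → 1 ≤ cutValue A X S
1≤cutValue {X = X} {S = S} {A = g ∷ _} (here refl) t with crosses X S g | t
... | true | _ = s≤s z≤n
1≤cutValue {X = X} {S = S} {A = g ∷ _} (there f∈A) t with crosses X S g
... | true  = s≤s z≤n
... | false = 1≤cutValue f∈A t

cutValue≤cutValue-auxGraph : ∀ (H : Hypergraph n) X S → cutValue H X S ≤ cutValue (auxGraph H) X S
cutValue≤cutValue-auxGraph []      X S = z≤n
cutValue≤cutValue-auxGraph (e ∷ H) X S
  rewrite cutValue-++ (clique e) (auxGraph H) X S with crosses X S e in crossing
... | true  = let _ , f∈Fe , t = clique-crosses {X = X} {S = S} {e = e} (from T-≡ crossing)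
              in +-mono-≤ (1≤cutValue {X = X} {S = S} f∈Fe t) (cutValue≤cutValue-auxGraph H X S)
... | false = ≤-trans (cutValue≤cutValue-auxGraph H X S) (m≤n+m _ _)

module _ {A : Set} (P : A → Bool) (f : A → ℕ) where

  minOver : ℕ → List A → ℕ
  minOver = foldr (λ a m → if P a then f a ⊓ m else m)

  maxOver : List A → ℕ
  maxOver = foldr (λ a m → if P a then f a ⊔ m else m) 0

  minOver≤ : ∀ {a} i as → a ∈ as → T (P a) → minOver i as ≤ f a
  minOver≤ i (a ∷ as) (here refl) t with P a | t
  ... | true | _ = m⊓n≤m _ _
  minOver≤ i (b ∷ as) (there a∈as) t with P b
  ... | true  = ≤-trans (m⊓n≤n _ _) (minOver≤ i as a∈as t)
  ... | false = minOver≤ i as a∈as t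

  minOver-glb : ∀ {k} i as → k ≤ i → (∀ {a} → a ∈ as → T (P a) → k ≤ f a) → k ≤ minOver i as
  minOver-glb i []       k≤i _     = k≤i
  minOver-glb i (a ∷ as) k≤i bound with P a in Pa
  ... | true  = ⊓-glb (bound (here refl) (from T-≡ Pa)) (minOver-glb i as k≤i (bound ∘ there))
  ... | false = minOver-glb i as k≤i (bound ∘ there)

  ≤maxOver : ∀ {a} as → a ∈ as → T (P a) → f a ≤ maxOver as
  ≤maxOver (a ∷ as) (here refl) t with P a | t
  ... | true | _ = m≤m⊔n _ _
  ≤maxOver (b ∷ as) (there a∈as) t with P b
  ... | true  = ≤-trans (≤maxOver as a∈as t) (m≤n⊔m _ _)
  ... | false = ≤maxOver as a∈as t

  maxOver-lub : ∀ {k} as → (∀ {a} → a ∈ as → T (P a) → f a ≤ k) → maxOver as ≤ k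
  maxOver-lub []       _     = z≤n
  maxOver-lub (a ∷ as) bound with P a in Pa
  ... | true  = ⊔-lub (bound (here refl) (from T-≡ Pa)) (maxOver-lub as (bound ∘ there))
  ... | false = maxOver-lub as (bound ∘ there)

∈-allSubsets : ∀ {n} (S : Subset n) → S ∈ allSubsets n
∈-allSubsets []            = here refl
∈-allSubsets (outside ∷ S) = ∈-++⁺ˡ (∈-map⁺ _ (∈-allSubsets S))
∈-allSubsets (inside ∷ S)  = ∈-++⁺ʳ _ (∈-map⁺ _ (∈-allSubsets S))

minCut≤cutValue : ∀ (H : Hypergraph n) → T (isCut X S) → minCut H X ≤ cutValue H X S
minCut≤cutValue {X = X} {S = S} H =
  minOver≤ (isCut X) (cutValue H X) (length H) (allSubsets _) (∈-allSubsets S)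

-- The cut S is needed: if X has no cut, minCut H X is the default value length H.
minCut-mono : ∀ (H H′ : Hypergraph n) → T (isCut X S) →
  (∀ {S} → T (isCut X S) → cutValue H X S ≤ cutValue H′ X S) → minCut H X ≤ minCut H′ X
minCut-mono {X = X} {S = S} H H′ cut cutValue≤ =
  minOver-glb (isCut X) (cutValue H′ X) (length H′) (allSubsets _)
    (≤-trans (minCut≤cutValue H cut) (≤-trans (cutValue≤ cut) (cutValue≤length H′ X S)))
    (λ _ cut′ → ≤-trans (minCut≤cutValue H cut′) (cutValue≤ cut′))

minCut≤minCut-auxGraph : ∀ (H : Hypergraph n) → x ∈ˢ X → y ∈ˢ X → x ≢ y →
  minCut H X ≤ minCut (auxGraph H) X
minCut≤minCut-auxGraph {x = x} {X = X} H x∈X y∈X x≢y =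
  minCut-mono {S = ⁅ x ⁆} H (auxGraph H)
    (isCut⁺ (pair⊆ x∈X x∈X ∘ p⊆p∪q ⁅ x ⁆) (x∈⁅x⁆ x) y∈X (x≢y⇒x∉⁅y⁆ (x≢y ∘ sym)))
    (λ {S} _ → cutValue≤cutValue-auxGraph H X S)

minCut≤strength : ∀ (H : Hypergraph n) → e ⊆ X → 2 ≤ ∣ X ∣ → minCut H X ≤ strength H e
minCut≤strength {e = e} {X = X} H e⊆X 2≤∣X∣ =
  ≤maxOver (λ Y → included e Y ∧ (2 ≤ᵇ ∣ Y ∣)) (minCut H) (allSubsets _) (∈-allSubsets X)
    (from T-∧ (⊆⇒included e⊆X , ≤⇒≤ᵇ 2≤∣X∣))

strength-lub : ∀ (H : Hypergraph n) {k} → (∀ {X} → e ⊆ X → 2 ≤ ∣ X ∣ → minCut H X ≤ k) →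
  strength H e ≤ k
strength-lub {e = e} H bound =
  maxOver-lub (λ Y → included e Y ∧ (2 ≤ᵇ ∣ Y ∣)) (minCut H) (allSubsets _) λ _ t →
    let e⊆X , 2≤∣X∣ = to T-∧ t in bound (included⇒⊆ e⊆X) (≤ᵇ⇒≤ 2 _ 2≤∣X∣)

mainTheorem11 : (n : ℕ) (H : Hypergraph n) (e : Subset n) → e ∈ H →
    (f : Subset n) → f ∈ clique e → strength H e ≤ strength (auxGraph H) f
mainTheorem11 n H e _ f f∈Fe with ∈-clique⁻ {e = e} f∈Fe
... | x , y , x<y , x∈e , y∈e , refl = strength-lub H λ e⊆X 2≤∣X∣ →
  let x∈X = e⊆X x∈e
      y∈X = e⊆X y∈e
  in ≤-trans (minCut≤minCut-auxGraph H x∈X y∈X (λ x≡y → <-irrefl (cong toℕ x≡y) x<y))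
             (minCut≤strength (auxGraph H) (pair⊆ x∈X y∈X) 2≤∣X∣)
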